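{- Let $\mathcal{G}=(\mathcal{V},\mathcal{E})$ be a finite graph with $|\mathcal{V}|\ge4$ and no isolated vertices. Then the graph device $D(\mathcal{G})$ is minimal.
   Context: An ASD is a pair $D=(\mathcal{S}_D,\mathcal{P}_D)$ with $\mathcal{S}_D$ a finite set and $\mathcal{P}_D$ a finite family of set partitions of $\mathcal{S}_D$. For partitions, $\pi\preceq\pi'$ means every block of $\pi$ lies in a block of $\pi'$; for $\phi:\mathcal{S}\to\mathcal{S}'$ and a partition $\pi$ of $\mathcal{S}'$, $\pi\circ\phi$ is the partition of $\mathcal{S}$ where $x,y$ share a block iff $\phi(x),\phi(y)$ share a block of $\pi$. $D\le D'$ means there exist $\phi:\mathcal{S}_D\to\mathcal{S}_{D'}$, $\alpha:\mathcal{P}_D\to\mathcal{P}_{D'}$ with $\alpha(\pi)\circ\phi\preceq\pi$ for all $\pi$; $D\equiv D'$ means $D\le D'$ and $D'\le D$. $D$ is minimal if there is no $D'\equiv D$ with fewer states and no $D'\equiv D$ with fewer partitions. For an undirected graph $\mathcal{G}=(\mathcal{V},\mathcal{E})$, the graph device $D(\mathcal{G})$ has state space $\mathcal{V}$ and partition set $\{\pi_e:e\in\mathcal{E}\}$, where for $e=\{u,v\}$, $\pi_e=\{\{u\},\{v\},\mathcal{V}\setminus\{u,v\}\}$. A vertex is isolated if it lies in no edge. -}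

module Defs where

open import Data.Nat using (ℕ; _<_; _≤_)
open import Data.Fin using (Fin; _≟_)
open import Data.Product using (Σ; _×_; _,_; proj₁; proj₂; ∃)
open import Data.Sum using (_⊎_)
open import Relation.Nullary using (¬_; yes; no)
open import Relation.Binary.PropositionalEquality using (_≡_; _≢_)

-- A set partition of a finite state set Fin n, represented by a block
-- labelling: x and y lie in the same block iff they get the same label.
Partition : ℕ → Set
Partition n = Fin n → ℕ

_⪯_ : ∀ {n} → Partition n → Partition n → Set
π ⪯ π' = ∀ x y → π x ≡ π y → π' x ≡ π' y

_∘ₚ_ : ∀ {n n'} → Partition n' → (Fin n → Fin n') → Partition n
(π ∘ₚ φ) x = π (φ x)

record ASD : Set where
  field
    states : ℕ
    parts  : ℕ
    part   : Fin parts → Partition states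
open ASD public

_≤ᴬ_ : ASD → ASD → Set
D ≤ᴬ D' = Σ (Fin (states D) → Fin (states D')) λ φ →
          Σ (Fin (parts D) → Fin (parts D')) λ α →
          ∀ i → (part D' (α i) ∘ₚ φ) ⪯ part D i

_≡ᴬ_ : ASD → ASD → Set
D ≡ᴬ D' = (D ≤ᴬ D') × (D' ≤ᴬ D)

Minimal : ASD → Set
Minimal D = (∀ D' → D' ≡ᴬ D → ¬ (states D' < states D))
          × (∀ D' → D' ≡ᴬ D → ¬ (parts D' < parts D))

SameEdge : ∀ {n} → Fin n × Fin n → Fin n × Fin n → Set
SameEdge (u , v) (u' , v') = (u ≡ u' × v ≡ v') ⊎ (u ≡ v' × v ≡ u')

record Graph (n : ℕ) : Set where
  field
    nEdges   : ℕ
    edge     : Fin nEdges → Fin n × Fin n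
    loopless : ∀ e → proj₁ (edge e) ≢ proj₂ (edge e)
    simple   : ∀ e e' → SameEdge (edge e) (edge e') → e ≡ e'
open Graph public

_∈ₑ_ : ∀ {n} → Fin n → Fin n × Fin n → Set
x ∈ₑ (u , v) = (x ≡ u) ⊎ (x ≡ v)

NoIsolated : ∀ {n} → Graph n → Set
NoIsolated {n} G = ∀ (x : Fin n) → ∃ λ e → x ∈ₑ edge G e

-- π_{u,v} = {{u},{v}, V ∖ {u,v}}, as a labelling (0 on u, 1 on v, 2 elsewhere).
edgePartition : ∀ {n} → Fin n × Fin n → Partition n
edgePartition (u , v) x with x ≟ u
... | yes _ = 0
... | no _ with x ≟ v
...   | yes _ = 1
...   | no _ = 2

graphDevice : ∀ {n} → Graph n → ASD
graphDevice {n} G = record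
  { states = n
  ; parts  = nEdges G
  ; part   = λ e → edgePartition (edge G e)
  }

module Submission where

-- Fewer states.  Every vertex x lies on some edge e, and x is a singleton
-- block of π_e.  Hence the state map φ of any simulation D(G) ≤ D' is
-- injective, so D' has at least n states.
--
-- If D(G) ≤ D' ≤ D(G), composing the two simulations
-- gives a self-simulation (f, γ) of D(G) with γ = β ∘ α; it suffices to show
-- that γ is injective.  The state map f is injective, and since n ≥ 4 some
-- vertex besides x lands outside {p, q} under f; so π_{p,q} ∘ f ⪯ π_{u,v}
-- forces f to map both u and v into {p, q}.  If γ e = γ e' for distinct
-- edges e, e', the three or more endpoints of e and e' would all be sent
-- injectively into the two-element set {p, q}, which is impossible.

open import Defs
open import Data.Nat using (ℕ; _≤_; _<_)
open import Data.Nat.Properties using (≤⇒≯)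
open import Data.Fin using (Fin; _≟_)
open import Data.Fin.Properties using (injective⇒≤; <⇒notInjective; ¬∀⟶∃¬)
open import Data.Product using (_×_; _,_; proj₁; proj₂; ∃)
open import Data.Sum using (_⊎_; inj₁; inj₂)
open import Data.Empty using (⊥-elim)
open import Relation.Nullary using (¬_; Dec; yes; no)
open import Relation.Nullary.Decidable using (_⊎-dec_)
open import Relation.Binary.PropositionalEquality using (_≡_; _≢_; refl; sym; trans; cong; subst)
open import Function using (_∘_)
open import Function.Definitions using (Injective)

_∈ₑ?_ : ∀ {n} (x : Fin n) (uv : Fin n × Fin n) → Dec (x ∈ₑ uv)
x ∈ₑ? (u , v) = (x ≟ u) ⊎-dec (x ≟ v)

data EdgeLabel {n} (u v x : Fin n) : ℕ → Set where
  at-u    : x ≡ u → EdgeLabel u v x 0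
  at-v    : x ≢ u → x ≡ v → EdgeLabel u v x 1
  outside : x ≢ u → x ≢ v → EdgeLabel u v x 2

edgeLabel : ∀ {n} (u v x : Fin n) → EdgeLabel u v x (edgePartition (u , v) x)
edgeLabel u v x with x ≟ u
... | yes x≡u = at-u x≡u
... | no x≢u with x ≟ v
...   | yes x≡v = at-v x≢u x≡v
...   | no x≢v = outside x≢u x≢v

edgePartition-singleton : ∀ {n} {u v x y : Fin n} → x ∈ₑ (u , v) →
  edgePartition (u , v) x ≡ edgePartition (u , v) y → x ≡ y
edgePartition-singleton {u = u} {v} {x} {y} x∈uv eq =
  sameBlock (edgeLabel u v x) (subst (EdgeLabel u v y) (sym eq) (edgeLabel u v y)) x∈uv
  where
  sameBlock : ∀ {k} → EdgeLabel u v x k → EdgeLabel u v y k → x ∈ₑ (u , v) → x ≡ y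
  sameBlock (at-u x≡u)   (at-u y≡u)   _          = trans x≡u (sym y≡u)
  sameBlock (at-v _ x≡v) (at-v _ y≡v) _          = trans x≡v (sym y≡v)
  sameBlock (outside x≢u _) _         (inj₁ x≡u) = ⊥-elim (x≢u x≡u)
  sameBlock (outside _ x≢v) _         (inj₂ x≡v) = ⊥-elim (x≢v x≡v)

edgePartition-outside : ∀ {n} {p q a b : Fin n} → ¬ a ∈ₑ (p , q) → ¬ b ∈ₑ (p , q) →
  edgePartition (p , q) a ≡ edgePartition (p , q) b
edgePartition-outside {p = p} {q} {a} {b} a∉pq b∉pq =
  trans (third (edgeLabel p q a) a∉pq) (sym (third (edgeLabel p q b) b∉pq))
  where
  third : ∀ {z k} → EdgeLabel p q z k → ¬ z ∈ₑ (p , q) → k ≡ 2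
  third (at-u z≡p)   z∉pq = ⊥-elim (z∉pq (inj₁ z≡p))
  third (at-v _ z≡q) z∉pq = ⊥-elim (z∉pq (inj₂ z≡q))
  third (outside _ _) _   = refl

≤ᴬ-trans : ∀ {D D' D''} → D ≤ᴬ D' → D' ≤ᴬ D'' → D ≤ᴬ D''
≤ᴬ-trans (φ , α , refines) (ψ , β , refines') =
  ψ ∘ φ , β ∘ α , λ i x y same → refines i x y (refines' (α i) (φ x) (φ y) same)

-- Without isolated vertices every state of D(G) is a singleton block of some
-- π_e, so the state map of any simulation of D(G) is injective.
simulation-state-injective : ∀ {n} (G : Graph n) → NoIsolated G →
  ∀ {D'} (s : graphDevice G ≤ᴬ D') → Injective _≡_ _≡_ (proj₁ s)
simulation-state-injective G noIso {D'} (φ , α , refines) {x} {y} φx≡φy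
  with noIso x
... | e , x∈e = edgePartition-singleton x∈e
                  (refines e x y (cong (part D' (α e)) φx≡φy))

-- An injective map sends at most three points into {x} ∪ f⁻¹{p, q}; so on
-- at least four points some y ≠ x has f y outside {p, q}.
escape : ∀ {n m} → 4 ≤ n → (f : Fin n → Fin m) → Injective _≡_ _≡_ f →
  (x : Fin n) (pq : Fin m × Fin m) → ∃ λ y → y ≢ x × ¬ f y ∈ₑ pq
escape {n} 4≤n f f-inj x pq with ¬∀⟶∃¬ n Blocked (λ y → (y ≟ x) ⊎-dec (f y ∈ₑ? pq)) notAllBlocked
  where
  Blocked : Fin n → Set
  Blocked y = (y ≡ x) ⊎ (f y ∈ₑ pq)

  reason : ∀ {y} → Blocked y → Fin 3
  reason (inj₁ _)        = Fin.zero
  reason (inj₂ (inj₁ _)) = Fin.suc Fin.zero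
  reason (inj₂ (inj₂ _)) = Fin.suc (Fin.suc Fin.zero)

  reason-injective : ∀ {i j} (bi : Blocked i) (bj : Blocked j) → reason bi ≡ reason bj → i ≡ j
  reason-injective (inj₁ i≡x)        (inj₁ j≡x)        _ = trans i≡x (sym j≡x)
  reason-injective (inj₂ (inj₁ fi≡p)) (inj₂ (inj₁ fj≡p)) _ = f-inj (trans fi≡p (sym fj≡p))
  reason-injective (inj₂ (inj₂ fi≡q)) (inj₂ (inj₂ fj≡q)) _ = f-inj (trans fi≡q (sym fj≡q))
  reason-injective (inj₁ _)        (inj₂ (inj₁ _)) ()
  reason-injective (inj₁ _)        (inj₂ (inj₂ _)) ()
  reason-injective (inj₂ (inj₁ _)) (inj₁ _)        ()
  reason-injective (inj₂ (inj₁ _)) (inj₂ (inj₂ _)) ()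
  reason-injective (inj₂ (inj₂ _)) (inj₁ _)        ()
  reason-injective (inj₂ (inj₂ _)) (inj₂ (inj₁ _)) ()

  notAllBlocked : ¬ (∀ y → Blocked y)
  notAllBlocked blocked =
    <⇒notInjective 4≤n (λ {i} {j} → reason-injective (blocked i) (blocked j))
... | y , unblocked = y , unblocked ∘ inj₁ , unblocked ∘ inj₂

endpoints-forced : ∀ {n m} → 4 ≤ n → (f : Fin n → Fin m) → Injective _≡_ _≡_ f →
  (pq : Fin m × Fin m) (uv : Fin n × Fin n) →
  (edgePartition pq ∘ₚ f) ⪯ edgePartition uv → ∀ {x} → x ∈ₑ uv → f x ∈ₑ pq
endpoints-forced 4≤n f f-inj pq uv refines {x} x∈uv with f x ∈ₑ? pq
... | yes fx∈pq = fx∈pq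
... | no fx∉pq with escape 4≤n f f-inj x pq
...   | y , y≢x , fy∉pq =
  ⊥-elim (y≢x (sym (edgePartition-singleton x∈uv
    (refines x y (edgePartition-outside fx∉pq fy∉pq)))))

new-endpoint : ∀ {n} (a b : Fin n × Fin n) → proj₁ b ≢ proj₂ b → ¬ SameEdge a b →
  ∃ λ c → c ∈ₑ b × ¬ c ∈ₑ a
new-endpoint (u , v) (u' , v') u'≢v' different with u' ∈ₑ? (u , v) | v' ∈ₑ? (u , v)
... | no u'∉uv | _          = u' , inj₁ refl , u'∉uv
... | yes _    | no v'∉uv   = v' , inj₂ refl , v'∉uv
... | yes (inj₁ u'≡u) | yes (inj₁ v'≡u) = ⊥-elim (u'≢v' (trans u'≡u (sym v'≡u)))
... | yes (inj₁ u'≡u) | yes (inj₂ v'≡v) = ⊥-elim (different (inj₁ (sym u'≡u , sym v'≡v)))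
... | yes (inj₂ u'≡v) | yes (inj₁ v'≡u) = ⊥-elim (different (inj₂ (sym v'≡u , sym u'≡v)))
... | yes (inj₂ u'≡v) | yes (inj₂ v'≡v) = ⊥-elim (u'≢v' (trans u'≡v (sym v'≡v)))

only-two-preimages : ∀ {n m} (f : Fin n → Fin m) → Injective _≡_ _≡_ f →
  ∀ {u v c : Fin n} {pq : Fin m × Fin m} → u ≢ v →
  f u ∈ₑ pq → f v ∈ₑ pq → f c ∈ₑ pq → c ∈ₑ (u , v)
only-two-preimages f f-inj u≢v (inj₁ fu≡p) (inj₁ fv≡p) _ = ⊥-elim (u≢v (f-inj (trans fu≡p (sym fv≡p))))
only-two-preimages f f-inj u≢v (inj₂ fu≡q) (inj₂ fv≡q) _ = ⊥-elim (u≢v (f-inj (trans fu≡q (sym fv≡q))))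
only-two-preimages f f-inj _ (inj₁ fu≡p) (inj₂ _) (inj₁ fc≡p) = inj₁ (f-inj (trans fc≡p (sym fu≡p)))
only-two-preimages f f-inj _ (inj₁ _) (inj₂ fv≡q) (inj₂ fc≡q) = inj₂ (f-inj (trans fc≡q (sym fv≡q)))
only-two-preimages f f-inj _ (inj₂ _) (inj₁ fv≡p) (inj₁ fc≡p) = inj₂ (f-inj (trans fc≡p (sym fv≡p)))
only-two-preimages f f-inj _ (inj₂ fu≡q) (inj₁ _) (inj₂ fc≡q) = inj₁ (f-inj (trans fc≡q (sym fu≡q)))

self-simulation-edge-injective : ∀ {n} → 4 ≤ n → (G : Graph n) → NoIsolated G →
  (s : graphDevice G ≤ᴬ graphDevice G) → Injective _≡_ _≡_ (proj₁ (proj₂ s))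
self-simulation-edge-injective 4≤n G noIso s@(f , γ , refines) {e} {e'} γe≡γe'
  with e ≟ e'
... | yes e≡e' = e≡e'
... | no e≢e'
  with new-endpoint (edge G e) (edge G e') (loopless G e') (e≢e' ∘ simple G e e')
... | c , c∈e' , c∉e = ⊥-elim (c∉e (only-two-preimages f f-inj (loopless G e)
                         (forcedOn e refl (inj₁ refl)) (forcedOn e refl (inj₂ refl))
                         (forcedOn e' γe≡γe' c∈e')))
  where
  f-inj : Injective _≡_ _≡_ f
  f-inj = simulation-state-injective G noIso {graphDevice G} s

  forcedOn : ∀ d → γ e ≡ γ d → ∀ {x} → x ∈ₑ edge G d → f x ∈ₑ edge G (γ e)
  forcedOn d γe≡γd = endpoints-forced 4≤n f f-inj (edge G (γ e)) (edge G d)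
    (subst (λ g → (edgePartition (edge G g) ∘ₚ f) ⪯ edgePartition (edge G d))
           (sym γe≡γd) (refines d))

lemma2 : (n : ℕ) → 4 ≤ n → (G : Graph n) → NoIsolated G → Minimal (graphDevice G)
lemma2 n 4≤n G noIso = fewerStates , fewerParts
  where
  fewerStates : ∀ D' → D' ≡ᴬ graphDevice G → ¬ (states D' < n)
  fewerStates D' (_ , DG≤D') =
    ≤⇒≯ (injective⇒≤ (simulation-state-injective G noIso {D'} DG≤D'))

  -- α is injective because β ∘ α, the edge map of a self-simulation, is.
  fewerParts : ∀ D' → D' ≡ᴬ graphDevice G → ¬ (parts D' < nEdges G)
  fewerParts D' (D'≤DG , DG≤D') = ≤⇒≯ (injective⇒≤ α-injective)
    where
    α-injective : Injective _≡_ _≡_ (proj₁ (proj₂ DG≤D'))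
    α-injective αe≡αe' = self-simulation-edge-injective 4≤n G noIso
      (≤ᴬ-trans {graphDevice G} {D'} {graphDevice G} DG≤D' D'≤DG) (cong (proj₁ (proj₂ D'≤DG)) αe≡αe')
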